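{- For every comeager set $G\subseteq 2^\omega\times 2^\omega$ there exist a Spinas tree $T\subseteq 2^{<\omega}$ and a dense $G_\delta$ set $B\subseteq 2^\omega$ such that $[T]\times B\subseteq G$. Moreover, $T$ contains a Silver tree (i.e. there is a Silver tree $S\subseteq T$).
   Context: A tree is a set $T\subseteq 2^{<\omega}$ closed under initial segments. $T$ is perfect if for every $\sigma\in T$ there is $\tau\supseteq\sigma$ with $\tau^\frown 0,\tau^\frown 1\in T$. $T$ is a Silver tree if it is perfect and there exist $x\in 2^\omega$ and an infinite $A\subseteq\omega$ such that for all $\sigma\in T$ and $n\in\mathrm{dom}(\sigma)\setminus A$, $\sigma(n)=x(n)$. $T$ is a Spinas tree if for every $\tau\in T$ there is $N\in\omega$ such that for all $n\ge N$ and $i\in\{0,1\}$ there is $\tau'\in T\cap 2^{n+1}$ with $\tau\subseteq\tau'$ and $\tau'(n)=i$. The body of $T$ is $[T]=\{x\in 2^\omega:\forall n\ (x\restriction n\in T)\}$. -}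

module Defs where

open import Data.Bool using (Bool; true; false)
open import Data.Nat using (ℕ; zero; suc; _<_; _≥_)
open import Data.List using (List; []; _∷_; _++_; [_]; length; lookup)
open import Data.Fin using (fromℕ<)
open import Data.Product using (Σ; ∃; _×_; _,_)
open import Relation.Binary.PropositionalEquality using (_≡_)
open import Relation.Nullary using (¬_)

Cantor : Set
Cantor = ℕ → Bool

Str : Set
Str = List Bool

_↾_ : Cantor → ℕ → Str
x ↾ zero = []
x ↾ suc n = x zero ∷ ((λ k → x (suc k)) ↾ n)

_⊑_ : Str → Str → Set
τ ⊑ σ = ∃ λ ρ → τ ++ ρ ≡ σ

_at_⟨_⟩ : (σ : Str) → (n : ℕ) → n < length σ → Bool
σ at n ⟨ p ⟩ = lookup σ (fromℕ< p)

IsTree : (Str → Set) → Set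
IsTree T = ∀ σ τ → τ ⊑ σ → T σ → T τ

IsPerfect : (Str → Set) → Set
IsPerfect T = IsTree T × T [] ×
  (∀ σ → T σ → ∃ λ τ → σ ⊑ τ × T (τ ++ [ false ]) × T (τ ++ [ true ]))

Infinite : (ℕ → Set) → Set
Infinite A = ∀ m → ∃ λ n → n ≥ m × A n

IsSilver : (Str → Set) → Set₁
IsSilver T = IsPerfect T × Σ Cantor λ x → Σ (ℕ → Set) λ A → Infinite A ×
  (∀ σ → T σ → ∀ n → (p : n < length σ) → ¬ A n → σ at n ⟨ p ⟩ ≡ x n)

IsSpinas : (Str → Set) → Set
IsSpinas T = IsTree T × T [] ×
  (∀ τ → T τ → ∃ λ N → ∀ n → n ≥ N → ∀ (i : Bool) →
     ∃ λ τ' → T τ' × Σ (length τ' ≡ suc n) λ e → τ ⊑ τ' ×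
       ((p : n < length τ') → τ' at n ⟨ p ⟩ ≡ i))

Body : (Str → Set) → Cantor → Set
Body T x = ∀ n → T (x ↾ n)

-- open subsets of 2^ω, coded by a set W of strings: U_W = ⋃_{σ∈W} [σ]
InOpen : (Str → Set) → Cantor → Set
InOpen W x = ∃ λ n → W (x ↾ n)

IsDenseGδ : (Cantor → Set) → Set₁
IsDenseGδ B =
  (Σ (ℕ → Str → Set) λ W → ∀ x → (B x → ∀ k → InOpen (W k) x) × ((∀ k → InOpen (W k) x) → B x))
  × (∀ σ → ∃ λ x → x ↾ length σ ≡ σ × B x)

-- open subsets of 2^ω × 2^ω, coded by a set W of pairs of strings: ⋃_{(σ,τ)∈W} [σ]×[τ]
InOpen² : (Str → Str → Set) → Cantor → Cantor → Set
InOpen² W x y = ∃ λ m → ∃ λ n → W (x ↾ m) (y ↾ n)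

DenseOpen² : (Str → Str → Set) → Set
DenseOpen² W = ∀ σ τ → ∃ λ x → ∃ λ y →
  x ↾ length σ ≡ σ × y ↾ length τ ≡ τ × InOpen² W x y

IsComeager : (Cantor → Cantor → Set) → Set₁
IsComeager G = Σ (ℕ → Str → Str → Set) λ W →
  (∀ k → DenseOpen² (W k)) × (∀ x y → (∀ k → InOpen² (W k) x y) → G x y)

{-# OPTIONS --safe #-}
-- The points of T are concatenations of blocks: block j is a free bit followed by a
-- fixed string c_j or its bitwise complement, and starts at position ℓ_j. Every
-- position of block j can be given either value by changing only block j, so above
-- ℓ_{|τ|} a node τ of T has extensions taking both values: T is a Spinas tree; never complementing leaves the Silver tree that is free exactly at the
-- positions ℓ_j. The strings c_j, together with strings d_j, are chosen at stage j by
-- finitely many extensions: for every k ≤ j, every ρ of length j and every way s of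
-- filling the blocks before j, each of the four variants of block j after s, times
-- ρ ++ d_j, is a box inside the k-th dense open set. Hence every point of [T] and
-- every y extending strings ρ ++ d_{|ρ|} with |ρ| arbitrarily large lie in every one
-- of these open sets, and such y form a dense G_δ set B.
module Submission where

open import Defs

open import Data.Bool using (Bool; true; false; not)
open import Data.Bool.Properties using (¬-not; not-involutive) renaming (_≟_ to _≟ᵇ_)
open import Data.Empty using (⊥-elim)
open import Data.List using (List; []; _∷_; _++_; [_]; length; map; upTo; cartesianProduct; cartesianProductWith)
open import Data.List.Properties using (++-assoc; ++-identityʳ; length-++; length-++-≤ˡ; map-++; map-∘; map-cong; map-id; ∷-injectiveˡ; ∷-injectiveʳ)
open import Data.List.Membership.Propositional using (_∈_)
open import Data.List.Membership.Propositional.Properties using (∈-cartesianProduct⁺; ∈-cartesianProductWith⁺; ∈-upTo⁺)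
open import Data.List.Relation.Unary.All as All using (All; []; _∷_)
open import Data.List.Relation.Unary.Any using (here; there)
open import Data.Nat using (ℕ; zero; suc; _+_; _∸_; _≤_; _<_; _≥_; z≤n; s≤s; _≤′_; ≤′-refl; ≤′-step; _≟_)
open import Data.Nat.Properties using (≤-refl; ≤-reflexive; ≤-trans; ≤-antisym; ≤-total; m≤n⇒m<n∨m≡n; m≤n⇒m≤1+n; ≤⇒≤′; m<m+n; m≤m+n; m≤n+m; m+[n∸m]≡n; m<n+o⇒m∸n<o; n∸n≡0; m∸n≡0⇒m≤n; <-irrefl)
open import Data.Product using (Σ; ∃; ∃₂; _×_; _,_; proj₁; proj₂)
open import Data.Sum using (inj₁; inj₂)
open import Relation.Nullary using (¬_; yes; no)
open import Relation.Binary.PropositionalEquality using (_≡_; refl; sym; trans; cong; cong₂; subst; module ≡-Reasoning)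
open ≡-Reasoning

⊑-refl : ∀ σ → σ ⊑ σ
⊑-refl σ = [] , ++-identityʳ σ

⊑-reflexive : ∀ {σ τ} → σ ≡ τ → σ ⊑ τ
⊑-reflexive {σ} refl = ⊑-refl σ

⊑-trans : ∀ {σ τ υ} → σ ⊑ τ → τ ⊑ υ → σ ⊑ υ
⊑-trans {σ} (ρ , refl) (ρ′ , refl) = ρ ++ ρ′ , sym (++-assoc σ ρ ρ′)

⊑-++ : ∀ σ ρ → σ ⊑ (σ ++ ρ)
⊑-++ σ ρ = ρ , refl

++-monoʳ-⊑ : ∀ ρ {σ τ} → σ ⊑ τ → (ρ ++ σ) ⊑ (ρ ++ τ)
++-monoʳ-⊑ ρ {σ} (υ , refl) = υ , ++-assoc ρ σ υ

length-snoc : ∀ (σ : Str) b → length (σ ++ [ b ]) ≡ suc (length σ)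
length-snoc [] b = refl
length-snoc (_ ∷ σ) b = cong suc (length-snoc σ b)

shift : Cantor → Cantor
shift x n = x (suc n)

length-↾ : ∀ x n → length (x ↾ n) ≡ n
length-↾ x zero = refl
length-↾ x (suc n) = cong suc (length-↾ (shift x) n)

↾-mono : ∀ x {m n} → m ≤ n → (x ↾ m) ⊑ (x ↾ n)
↾-mono x {zero} {n} _ = x ↾ n , refl
↾-mono x {suc m} {suc n} (s≤s m≤n) with ↾-mono (shift x) m≤n
... | ρ , eq = ρ , cong (x zero ∷_) eq

⊑-↾ : ∀ {τ} x m → τ ⊑ (x ↾ m) → x ↾ length τ ≡ τ
⊑-↾ {[]} x m _ = refl
⊑-↾ {b ∷ τ} x (suc m) (ρ , eq) =
  cong₂ _∷_ (sym (∷-injectiveˡ eq)) (⊑-↾ (shift x) m (ρ , ∷-injectiveʳ eq))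

↾-suc : ∀ x n → x ↾ suc n ≡ x ↾ n ++ [ x n ]
↾-suc x zero = refl
↾-suc x (suc n) = cong (x zero ∷_) (↾-suc (shift x) n)

↾-cong : ∀ x y m → (∀ n → n < m → x n ≡ y n) → x ↾ m ≡ y ↾ m
↾-cong x y zero _ = refl
↾-cong x y (suc m) x≗y =
  cong₂ _∷_ (x≗y zero (s≤s z≤n)) (↾-cong (shift x) (shift y) m (λ n n<m → x≗y (suc n) (s≤s n<m)))

↾-at : ∀ x {σ} n → x ↾ length σ ≡ σ → (p : n < length σ) → σ at n ⟨ p ⟩ ≡ x n
↾-at x {_ ∷ σ} zero eq (s≤s _) = sym (∷-injectiveˡ eq)
↾-at x {_ ∷ σ} (suc n) eq (s≤s p) = ↾-at (shift x) n (∷-injectiveʳ eq) p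

pad : Str → Cantor
pad [] _ = false
pad (b ∷ σ) zero = b
pad (b ∷ σ) (suc n) = pad σ n

pad-++ˡ : ∀ σ ρ {n} → n < length σ → pad (σ ++ ρ) n ≡ pad σ n
pad-++ˡ (b ∷ σ) ρ {zero} _ = refl
pad-++ˡ (b ∷ σ) ρ {suc n} (s≤s n<σ) = pad-++ˡ σ ρ n<σ

pad-++ʳ : ∀ σ ρ r → pad (σ ++ ρ) (length σ + r) ≡ pad ρ r
pad-++ʳ [] ρ r = refl
pad-++ʳ (b ∷ σ) ρ r = pad-++ʳ σ ρ r

pad-⊑ : ∀ {σ τ n} → σ ⊑ τ → n < length σ → pad τ n ≡ pad σ n
pad-⊑ {σ} (ρ , refl) = pad-++ˡ σ ρ

↾-pad : ∀ x σ → (∀ n → n < length σ → x n ≡ pad σ n) → x ↾ length σ ≡ σ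
↾-pad x [] _ = refl
↾-pad x (b ∷ σ) x≗σ =
  cong₂ _∷_ (x≗σ zero (s≤s z≤n)) (↾-pad (shift x) σ (λ n n<σ → x≗σ (suc n) (s≤s n<σ)))

pad-↾ : ∀ x σ → x ↾ length σ ≡ σ → ∀ {n} → n < length σ → x n ≡ pad σ n
pad-↾ x (b ∷ σ) eq {zero} _ = ∷-injectiveˡ eq
pad-↾ x (b ∷ σ) eq {suc n} (s≤s n<σ) = pad-↾ (shift x) σ (∷-injectiveʳ eq) n<σ

⊑-chain : (σs : ℕ → Str) → (∀ k → σs k ⊑ σs (suc k)) → ∀ {k k′} → k ≤ k′ → σs k ⊑ σs k′
⊑-chain σs step k≤k′ = go (≤⇒≤′ k≤k′)
  where
  go : ∀ {k k′} → k ≤′ k′ → σs k ⊑ σs k′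
  go ≤′-refl = ⊑-refl _
  go (≤′-step k≤k′) = ⊑-trans (go k≤k′) (step _)

limit : (ℕ → Str) → Cantor
limit σs n = pad (σs (suc n)) n

limit-↾ : (σs : ℕ → Str) → (∀ k → σs k ⊑ σs (suc k)) → (∀ k → k ≤ length (σs k)) →
          ∀ k → limit σs ↾ length (σs k) ≡ σs k
limit-↾ σs step long k = ↾-pad (limit σs) (σs k) agree
  where
  agree : ∀ n → n < length (σs k) → pad (σs (suc n)) n ≡ pad (σs k) n
  agree n n<σk with ≤-total k (suc n)
  ... | inj₁ k≤ = pad-⊑ (⊑-chain σs step k≤) n<σk
  ... | inj₂ ≤k = sym (pad-⊑ (⊑-chain σs step ≤k) (long (suc n)))

treeOf : {C : Set} → (C → Cantor) → Str → Set
treeOf f σ = ∃ λ c → f c ↾ length σ ≡ σ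

treeOf-isTree : {C : Set} (f : C → Cantor) → IsTree (treeOf f)
treeOf-isTree f σ τ τ⊑σ (c , fc↾σ) = c , ⊑-↾ (f c) (length σ) (⊑-trans τ⊑σ (⊑-reflexive (sym fc↾σ)))

↾∈treeOf : {C : Set} (f : C → Cantor) → ∀ c n → treeOf f (f c ↾ n)
↾∈treeOf f c n = c , cong (f c ↾_) (length-↾ (f c) n)

bracket : (f : ℕ → ℕ) → (∀ j → f j < f (suc j)) →
          ∀ {M} n → f M ≤ n → ∃ λ j → M ≤ j × f j ≤ n × n < f (suc j)
bracket f f-step {M} n fM≤n with m≤n⇒m<n∨m≡n fM≤n
... | inj₂ refl = M , ≤-refl , ≤-refl , f-step M
bracket f f-step (suc n) _ | inj₁ (s≤s fM≤n) with bracket f f-step n fM≤n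
... | j , M≤j , fj≤n , n<fj′ with m≤n⇒m<n∨m≡n n<fj′
...   | inj₁ sn<fj′ = j , M≤j , m≤n⇒m≤1+n fj≤n , sn<fj′
...   | inj₂ sn≡fj′ = suc j , m≤n⇒m≤1+n M≤j , ≤-reflexive (sym sn≡fj′) ,
                      subst (_< f (suc (suc j))) (sym sn≡fj′) (f-step (suc j))

bools : List Bool
bools = false ∷ true ∷ []

∈-bools : ∀ b → b ∈ bools
∈-bools false = here refl
∈-bools true = there (here refl)

strings : ℕ → List Str
strings zero = [ [] ]
strings (suc n) = cartesianProductWith _∷_ bools (strings n)

∈-strings : ∀ σ → σ ∈ strings (length σ)
∈-strings [] = here refl
∈-strings (b ∷ σ) = ∈-cartesianProductWith⁺ _∷_ (∈-bools b) (∈-strings σ)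

module _ {A I : Set} (_≼_ : A → A → Set) (≼-refl : ∀ {a} → a ≼ a)
         (≼-trans : ∀ {a b c} → a ≼ b → b ≼ c → a ≼ c)
         (P : I → A → Set) (P-mono : ∀ i {a b} → a ≼ b → P i a → P i b)
         (force : ∀ i a → ∃ λ b → a ≼ b × P i b) where

  forceAll : ∀ is a → ∃ λ b → a ≼ b × All (λ i → P i b) is
  forceAll [] a = a , ≼-refl , []
  forceAll (i ∷ is) a with force i a
  ... | b , a≼b , Pib with forceAll is b
  ...   | c , b≼c , Pisc = c , ≼-trans a≼b b≼c , P-mono i b≼c Pib ∷ Pisc

BoxIn : (Str → Str → Set) → Str → Str → Set
BoxIn W α β = ∃₂ λ γ δ → W γ δ × γ ⊑ α × δ ⊑ β

BoxIn-mono : ∀ {W α α′ β β′} → α ⊑ α′ → β ⊑ β′ → BoxIn W α β → BoxIn W α′ β′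
BoxIn-mono α⊑ β⊑ (γ , δ , w , γ⊑ , δ⊑) = γ , δ , w , ⊑-trans γ⊑ α⊑ , ⊑-trans δ⊑ β⊑

DenseOpen²-extend : ∀ {W} → DenseOpen² W →
                    ∀ α β → ∃₂ λ α′ β′ → α ⊑ α′ × β ⊑ β′ × BoxIn W α′ β′
DenseOpen²-extend dense α β with dense α β
... | x , y , x↾α , y↾β , m , n , w =
  x ↾ (length α + m) , y ↾ (length β + n) ,
  ⊑-trans (⊑-reflexive (sym x↾α)) (↾-mono x (m≤m+n (length α) m)) ,
  ⊑-trans (⊑-reflexive (sym y↾β)) (↾-mono y (m≤m+n (length β) n)) ,
  x ↾ m , y ↾ n , w , ↾-mono x (m≤n+m m (length α)) , ↾-mono y (m≤n+m n (length β))

BoxIn-InOpen² : ∀ {W} x y {m n} → BoxIn W (x ↾ m) (y ↾ n) → InOpen² W x y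
BoxIn-InOpen² {W} x y (γ , δ , w , γ⊑ , δ⊑) =
  length γ , length δ , subst (λ γ′ → W γ′ (y ↾ length δ)) (sym (⊑-↾ x _ γ⊑))
                          (subst (W γ) (sym (⊑-↾ y _ δ⊑)) w)

complementIf : Bool → Str → Str
complementIf false σ = σ
complementIf true σ = map not σ

complementIf-++ : ∀ f σ ρ → complementIf f (σ ++ ρ) ≡ complementIf f σ ++ complementIf f ρ
complementIf-++ false σ ρ = refl
complementIf-++ true σ ρ = map-++ not σ ρ

complementIf-involutive : ∀ f σ → complementIf f (complementIf f σ) ≡ σ
complementIf-involutive false σ = refl
complementIf-involutive true σ = trans (sym (map-∘ σ)) (trans (map-cong not-involutive σ) (map-id σ))

length-complementIf : ∀ f σ → length (complementIf f σ) ≡ length σ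
length-complementIf false σ = refl
length-complementIf true [] = refl
length-complementIf true (b ∷ σ) = cong suc (length-complementIf true σ)

pad-map-not : ∀ σ {r} → r < length σ → pad (map not σ) r ≡ not (pad σ r)
pad-map-not (b ∷ σ) {zero} _ = refl
pad-map-not (b ∷ σ) {suc r} (s≤s r<σ) = pad-map-not σ r<σ

-- A choice is the free bit of a block and whether to complement the rest.
Choice : Set
Choice = Bool × Bool

choices : List Choice
choices = cartesianProduct bools bools

∈-choices : ∀ o → o ∈ choices
∈-choices (b , f) = ∈-cartesianProduct⁺ (∈-bools b) (∈-bools f)

block : Choice → Str → Str
block o σ = proj₁ o ∷ complementIf (proj₂ o) σ

length-block : ∀ o σ → length (block o σ) ≡ suc (length σ)
length-block o σ = cong suc (length-complementIf (proj₂ o) σ)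

block-++ : ∀ o σ ρ → block o (σ ++ complementIf (proj₂ o) ρ) ≡ block o σ ++ ρ
block-++ (b , f) σ ρ = cong (b ∷_) (begin
  complementIf f (σ ++ complementIf f ρ)                 ≡⟨ complementIf-++ f σ _ ⟩
  complementIf f σ ++ complementIf f (complementIf f ρ)  ≡⟨ cong (complementIf f σ ++_) (complementIf-involutive f ρ) ⟩
  complementIf f σ ++ ρ                                  ∎)

block-mono : ∀ o {σ τ} → σ ⊑ τ → block o σ ⊑ block o τ
block-mono (b , f) {σ} (ρ , refl) = complementIf f ρ , cong (b ∷_) (sym (complementIf-++ f σ ρ))

block-hits : ∀ σ {n} → n < suc (length σ) → ∀ i → ∃ λ o → pad (block o σ) n ≡ i
block-hits σ {zero} _ i = (i , false) , refl
block-hits σ {suc r} (s≤s r<σ) i with pad σ r ≟ᵇ i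
... | yes σr≡i = (false , false) , σr≡i
... | no σr≢i = (false , true) , trans (pad-map-not σ r<σ) (sym (¬-not (λ i≡σr → σr≢i (sym i≡σr))))

_[_≔_] : {A : Set} → (ℕ → A) → ℕ → A → ℕ → A
(e [ j ≔ a ]) i with i ≟ j
... | yes _ = a
... | no _ = e i

[≔]-same : {A : Set} (e : ℕ → A) → ∀ j a → (e [ j ≔ a ]) j ≡ a
[≔]-same e j a with j ≟ j
... | yes _ = refl
... | no j≢j = ⊥-elim (j≢j refl)

[≔]-< : {A : Set} (e : ℕ → A) → ∀ {i j} a → i < j → (e [ j ≔ a ]) i ≡ e i
[≔]-< e {i} {j} a i<j with i ≟ j
... | yes refl = ⊥-elim (<-irrefl refl i<j)
... | no _ = refl

module Construction (W : ℕ → Str → Str → Set) (W-dense : ∀ k → DenseOpen² (W k)) where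

  Requirement : Set
  Requirement = Str × ℕ × Str × Choice

  _≼_ : Str × Str → Str × Str → Set
  (c , d) ≼ (c′ , d′) = c ⊑ c′ × d ⊑ d′

  Meets : Requirement → Str × Str → Set
  Meets (ρ , k , s , o) (c , d) = BoxIn (W k) (s ++ block o c) (ρ ++ d)

  Meets-mono : ∀ r {a b} → a ≼ b → Meets r a → Meets r b
  Meets-mono (ρ , k , s , o) (c⊑ , d⊑) = BoxIn-mono (++-monoʳ-⊑ s (block-mono o c⊑)) (++-monoʳ-⊑ ρ d⊑)

  meet : ∀ r a → ∃ λ b → a ≼ b × Meets r b
  meet (ρ , k , s , o) (c , d) with DenseOpen²-extend (W-dense k) (s ++ block o c) (ρ ++ d)
  ... | _ , _ , (v , refl) , (w , refl) , box =
    (c ++ complementIf (proj₂ o) v , d ++ w) , (⊑-++ c _ , ⊑-++ d w) ,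
    BoxIn-mono (⊑-reflexive block-eq) (⊑-reflexive (++-assoc ρ d w)) box
    where
    block-eq : (s ++ block o c) ++ v ≡ s ++ block o (c ++ complementIf (proj₂ o) v)
    block-eq = trans (++-assoc s _ v) (cong (s ++_) (sym (block-++ o c v)))

  requirements : ℕ → ℕ → List Requirement
  requirements j m =
    cartesianProduct (strings j) (cartesianProduct (upTo (suc j)) (cartesianProduct (strings m) choices))

  stage-meets-all : ∀ j m → ∃ λ a → ([] , []) ≼ a × All (λ r → Meets r a) (requirements j m)
  stage-meets-all j m =
    forceAll _≼_ (⊑-refl _ , ⊑-refl _) (λ (c⊑ , d⊑) (c⊑′ , d⊑′) → ⊑-trans c⊑ c⊑′ , ⊑-trans d⊑ d⊑′)
      Meets Meets-mono meet (requirements j m) ([] , [])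

  stage : ℕ → ℕ → Str × Str
  stage j m = proj₁ (stage-meets-all j m)

  stage-meets : ∀ j m {ρ k s} o → length ρ ≡ j → k ≤ j → length s ≡ m → Meets (ρ , k , s , o) (stage j m)
  stage-meets j m {ρ} {k} {s} o refl k≤j refl =
    All.lookup (proj₂ (proj₂ (stage-meets-all j m)))
      (∈-cartesianProduct⁺ (∈-strings ρ)
        (∈-cartesianProduct⁺ (∈-upTo⁺ (s≤s k≤j)) (∈-cartesianProduct⁺ (∈-strings s) (∈-choices o))))

  -- Block j occupies the positions ℓ j … ℓ (suc j) - 1: a free bit, then c j or its complement.
  -- The strings d j extend the second coordinate.
  ℓ : ℕ → ℕ
  ℓ zero = 0
  ℓ (suc j) = ℓ j + suc (length (proj₁ (stage j (ℓ j))))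

  c : ℕ → Str
  c j = proj₁ (stage j (ℓ j))

  d : ℕ → Str
  d j = proj₂ (stage j (ℓ j))

  ℓ-step : ∀ j → ℓ j < ℓ (suc j)
  ℓ-step j = m<m+n (ℓ j) (s≤s z≤n)

  ℓ-ge : ∀ j → j ≤ ℓ j
  ℓ-ge zero = z≤n
  ℓ-ge (suc j) = ≤-trans (s≤s (ℓ-ge j)) (ℓ-step j)

  Code : Set
  Code = ℕ → Choice

  prefix : Code → ℕ → Str
  prefix e zero = []
  prefix e (suc j) = prefix e j ++ block (e j) (c j)

  length-prefix : ∀ e j → length (prefix e j) ≡ ℓ j
  length-prefix e zero = refl
  length-prefix e (suc j) =
    trans (length-++ (prefix e j)) (cong₂ _+_ (length-prefix e j) (length-block (e j) (c j)))

  prefix-agree : ∀ e e′ j → (∀ i → i < j → e i ≡ e′ i) → prefix e j ≡ prefix e′ j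
  prefix-agree e e′ zero _ = refl
  prefix-agree e e′ (suc j) e≗e′ =
    cong₂ _++_ (prefix-agree e e′ j (λ i i<j → e≗e′ i (m≤n⇒m≤1+n i<j)))
               (cong (λ o → block o (c j)) (e≗e′ j ≤-refl))

  point : Code → Cantor
  point e = limit (prefix e)

  point-↾ : ∀ e j → point e ↾ ℓ j ≡ prefix e j
  point-↾ e j = subst (λ m → point e ↾ m ≡ prefix e j) (length-prefix e j)
    (limit-↾ (prefix e) (λ j → ⊑-++ (prefix e j) _)
      (λ j → subst (j ≤_) (sym (length-prefix e j)) (ℓ-ge j)) j)

  point-pad : ∀ e j {n} → n < ℓ j → point e n ≡ pad (prefix e j) n
  point-pad e j n<ℓj =
    pad-↾ (point e) (prefix e j) (subst (λ m → point e ↾ m ≡ prefix e j) (sym (length-prefix e j)) (point-↾ e j))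
      (subst (_ <_) (sym (length-prefix e j)) n<ℓj)

  point-agree : ∀ e e′ j → (∀ i → i < j → e i ≡ e′ i) → ∀ n → n < ℓ j → point e n ≡ point e′ n
  point-agree e e′ j e≗e′ n n<ℓj =
    trans (point-pad e j n<ℓj) (trans (cong (λ σ → pad σ n) (prefix-agree e e′ j e≗e′)) (sym (point-pad e′ j n<ℓj)))

  point-block : ∀ e j {n} → ℓ j ≤ n → n < ℓ (suc j) → point e n ≡ pad (block (e j) (c j)) (n ∸ ℓ j)
  point-block e j {n} ℓj≤n n<ℓj′ = begin
    point e n                                                ≡⟨ point-pad e (suc j) n<ℓj′ ⟩
    pad (prefix e j ++ block (e j) (c j)) n                  ≡⟨ cong (pad (prefix e j ++ block (e j) (c j))) (sym (m+[n∸m]≡n ℓj≤n)) ⟩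
    pad (prefix e j ++ block (e j) (c j)) (ℓ j + (n ∸ ℓ j))  ≡⟨ subst (λ m → pad (prefix e j ++ block (e j) (c j)) (m + (n ∸ ℓ j)) ≡ pad (block (e j) (c j)) (n ∸ ℓ j))
                                                                  (length-prefix e j) (pad-++ʳ (prefix e j) _ (n ∸ ℓ j)) ⟩
    pad (block (e j) (c j)) (n ∸ ℓ j)                        ∎

  point-head : ∀ e j → point e (ℓ j) ≡ proj₁ (e j)
  point-head e j = trans (point-block e j ≤-refl (ℓ-step j)) (cong (pad (block (e j) (c j))) (n∸n≡0 (ℓ j)))

  point-hits : ∀ e j {n} → ℓ j ≤ n → n < ℓ (suc j) → ∀ i → ∃ λ o → point (e [ j ≔ o ]) n ≡ i
  point-hits e j {n} ℓj≤n n<ℓj′ i with block-hits (c j) (m<n+o⇒m∸n<o n (ℓ j) n<ℓj′) i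
  ... | o , hit = o , trans (point-block (e [ j ≔ o ]) j ℓj≤n n<ℓj′)
                            (trans (cong (λ o′ → pad (block o′ (c j)) (n ∸ ℓ j)) ([≔]-same e j o)) hit)

  T : Str → Set
  T = treeOf point

  T-spinas : IsSpinas T
  T-spinas = treeOf-isTree point , ↾∈treeOf point (λ _ → false , false) 0 , spinas
    where
    spinas : ∀ τ → T τ → ∃ λ N → ∀ n → n ≥ N → ∀ i →
             ∃ λ τ′ → T τ′ × Σ (length τ′ ≡ suc n) λ _ → τ ⊑ τ′ × ((p : n < length τ′) → τ′ at n ⟨ p ⟩ ≡ i)
    spinas τ (e , e↾τ) = ℓ (length τ) , extend
      where
      extend : ∀ n → n ≥ ℓ (length τ) → ∀ i →
               ∃ λ τ′ → T τ′ × Σ (length τ′ ≡ suc n) λ _ → τ ⊑ τ′ × ((p : n < length τ′) → τ′ at n ⟨ p ⟩ ≡ i)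
      extend n n≥ i with bracket ℓ ℓ-step n n≥
      ... | j , τ≤j , ℓj≤n , n<ℓj′ with point-hits e j ℓj≤n n<ℓj′ i
      ...   | o , hit =
        point e′ ↾ suc n , ↾∈treeOf point e′ (suc n) , length-↾ (point e′) (suc n) , τ⊑ ,
        λ p → trans (↾-at (point e′) n (proj₂ (↾∈treeOf point e′ (suc n))) p) hit
        where
        e′ = e [ j ≔ o ]
        τ≤ℓj : length τ ≤ ℓ j
        τ≤ℓj = ≤-trans τ≤j (ℓ-ge j)
        agree : ∀ m → m < length τ → point e m ≡ point e′ m
        agree m m<τ = point-agree e e′ j (λ i′ i′<j → sym ([≔]-< e o i′<j)) m (≤-trans m<τ τ≤ℓj)
        τ⊑ : τ ⊑ (point e′ ↾ suc n)
        τ⊑ = ⊑-trans (⊑-reflexive (trans (sym e↾τ) (↾-cong (point e) (point e′) (length τ) agree)))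
                     (↾-mono (point e′) (m≤n⇒m≤1+n (≤-trans τ≤ℓj ℓj≤n)))

  plain : (ℕ → Bool) → Code
  plain b j = b j , false

  S : Str → Set
  S = treeOf (λ b → point (plain b))

  S⊆T : ∀ σ → S σ → T σ
  S⊆T σ (b , b↾σ) = plain b , b↾σ

  S-branch : ∀ σ → S σ → ∃ λ τ → σ ⊑ τ × S (τ ++ [ false ]) × S (τ ++ [ true ])
  S-branch σ (b , b↾σ) = τ , ⊑-trans (⊑-reflexive (sym b↾σ)) (↾-mono _ (ℓ-ge M)) , branch false , branch true
    where
    M = length σ
    τ = point (plain b) ↾ ℓ M
    branch : ∀ i → S (τ ++ [ i ])
    branch i = subst S τi-eq (↾∈treeOf (λ b → point (plain b)) b′ (suc (ℓ M)))
      where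
      b′ = b [ M ≔ i ]
      agree : ∀ n → n < ℓ M → point (plain b′) n ≡ point (plain b) n
      agree = point-agree (plain b′) (plain b) M (λ k k<M → cong (_, false) ([≔]-< b i k<M))
      τi-eq : point (plain b′) ↾ suc (ℓ M) ≡ τ ++ [ i ]
      τi-eq = begin
        point (plain b′) ↾ suc (ℓ M)                           ≡⟨ ↾-suc (point (plain b′)) (ℓ M) ⟩
        point (plain b′) ↾ ℓ M ++ [ point (plain b′) (ℓ M) ]   ≡⟨ cong₂ (λ u v → u ++ [ v ])
                                                                     (↾-cong _ _ (ℓ M) agree)
                                                                     (trans (point-head (plain b′) M) ([≔]-same b M i)) ⟩
        τ ++ [ i ]                                             ∎

  IsLevel : ℕ → Set
  IsLevel n = ∃ λ j → n ≡ ℓ j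

  plain-off-level : ∀ b b′ n → ¬ IsLevel n → point (plain b) n ≡ point (plain b′) n
  plain-off-level b b′ n n∉ with bracket ℓ ℓ-step {0} n z≤n
  ... | j , _ , ℓj≤n , n<ℓj′ =
    trans (point-block (plain b) j ℓj≤n n<ℓj′) (trans inside-block (sym (point-block (plain b′) j ℓj≤n n<ℓj′)))
    where
    inside-block : pad (block (plain b j) (c j)) (n ∸ ℓ j) ≡ pad (block (plain b′ j) (c j)) (n ∸ ℓ j)
    inside-block with n ∸ ℓ j in eq
    ... | zero = ⊥-elim (n∉ (j , ≤-antisym (m∸n≡0⇒m≤n eq) ℓj≤n))
    ... | suc r = refl

  S-silver : IsSilver S
  S-silver =
    (treeOf-isTree _ , ↾∈treeOf (λ b → point (plain b)) (λ _ → false) 0 , S-branch) ,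
    point (plain (λ _ → false)) , IsLevel , (λ m → ℓ m , ℓ-ge m , m , refl) ,
    λ σ (b , b↾σ) n p n∉ → trans (↾-at _ n b↾σ p) (plain-off-level b _ n n∉)

  Wᴮ : ℕ → Str → Set
  Wᴮ k β = ∃ λ ρ → k ≤ length ρ × β ≡ ρ ++ d (length ρ)

  B : Cantor → Set
  B y = ∀ k → InOpen (Wᴮ k) y

  B-dense : ∀ σ → ∃ λ y → y ↾ length σ ≡ σ × B y
  B-dense σ = limit walk , limit-↾ walk step long 0 , λ k →
    length (walk k ++ d (length (walk k))) , walk k , long k ,
    ⊑-↾ (limit walk) (length (walk (suc k)))
        (⊑-trans (⊑-++ _ [ false ]) (⊑-reflexive (sym (limit-↾ walk step long (suc k)))))
    where
    walk : ℕ → Str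
    walk zero = σ
    walk (suc k) = (walk k ++ d (length (walk k))) ++ [ false ]
    step : ∀ k → walk k ⊑ walk (suc k)
    step k = ⊑-trans (⊑-++ (walk k) _) (⊑-++ _ [ false ])
    long : ∀ k → k ≤ length (walk k)
    long zero = z≤n
    long (suc k) = subst (suc k ≤_) (sym (length-snoc (walk k ++ d (length (walk k))) false))
                         (s≤s (≤-trans (long k) (length-++-≤ˡ (walk k))))

  B-denseGδ : IsDenseGδ B
  B-denseGδ = (Wᴮ , λ y → (λ y∈B → y∈B) , (λ y∈B → y∈B)) , B-dense

  Body×B⊆W : ∀ k x y → Body T x → B y → InOpen² (W k) x y
  Body×B⊆W k x y x∈T y∈B with y∈B k
  ... | m , ρ , k≤ρ , y↾m with x∈T (ℓ (suc (length ρ)))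
  ...   | e , e↾x = BoxIn-InOpen² x y (BoxIn-mono (⊑-reflexive (sym x↾)) (⊑-reflexive (sym y↾m))
                      (stage-meets j (ℓ j) (e j) refl k≤ρ (length-prefix e j)))
    where
    j = length ρ
    x↾ : x ↾ ℓ (suc j) ≡ prefix e (suc j)
    x↾ = trans (sym (trans (cong (point e ↾_) (sym (length-↾ x (ℓ (suc j))))) e↾x)) (point-↾ e (suc j))

mainTheorem6 : (G : Cantor → Cantor → Set) → IsComeager G →
    Σ (Str → Set) λ T → Σ (Cantor → Set) λ B →
      IsSpinas T × IsDenseGδ B × (∀ x y → Body T x → B y → G x y) ×
      Σ (Str → Set) λ S → IsSilver S × (∀ σ → S σ → T σ)
mainTheorem6 G (W , W-dense , W⊆G) =
  T , B , T-spinas , B-denseGδ , (λ x y x∈T y∈B → W⊆G x y (λ k → Body×B⊆W k x y x∈T y∈B)) ,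
  S , S-silver , S⊆T
  where open Construction W W-dense
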